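{- Let $N$ be a squarefree integer and let $n$ be an odd positive integer coprime to $N$. Fix an odd integer $0<n_0<2N$ such that the Legendre symbol $\left(\frac{n_0^2-4n}{p}\right)=-1$ for all odd primes $p\mid N$. Then for any integer $t\equiv n_0\pmod{2N}$ with $t^2<4n$ and any positive integer $f$ with $f^2\mid t^2-4n$ and $(t^2-4n)/f^2\equiv 0$ or $1\pmod 4$, we have $\tilde\mu(t,f,n,N)=\sigma(N)\mu(N)$.
   Context: $\sigma(m)$ is the number of divisors of $m$ and $\mu$ the Möbius function. Let $\nu(N)=N\prod_{p\mid N}(1+\frac1p)$; $M(t,n,K)$ the number of solutions $x\bmod K$ of $x^2-tx+n\equiv0\pmod K$; $\mu(t,f,n,d)=\frac{\nu(d)}{\nu(d/\gcd(d,f))}M(t,n,d\gcd(d,f))$; and $\tilde\mu(t,f,n,N)=\sum_{d\mid N}\sigma(N/d)\mu(N/d)\mu(t,f,n,d)$. -}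

module Defs where

open import Data.Nat as ℕ using (ℕ; zero; suc; _∸_)
open import Data.Nat.Divisibility using (_∣?_; _∣_)
open import Data.Nat.GCD using (gcd)
open import Data.Nat.Primality using (prime?)
open import Data.Integer as ℤ using (ℤ; +_; _%ℕ_)
open import Data.Rational as ℚ using (ℚ; 0ℚ; 1ℚ)
open import Data.Rational.Properties as ℚP using ()
open import Data.List using (List; []; _∷_; filter; length; upTo; map; foldr)
open import Data.Bool using (if_then_else_)
open import Relation.Nullary using (yes; no; does)
open import Relation.Nullary.Decidable using (¬?)
open import Relation.Binary.PropositionalEquality using (_≡_)

range1 : ℕ → List ℕ
range1 m = map suc (upTo m)

divisors : ℕ → List ℕ
divisors m = filter (λ d → d ∣? m) (range1 m)

primeDivisors : ℕ → List ℕ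
primeDivisors m = filter prime? (divisors m)

sumℚ : List ℚ → ℚ
sumℚ = foldr ℚ._+_ 0ℚ

prodℚ : List ℚ → ℚ
prodℚ = foldr ℚ._*_ 1ℚ

σ : ℕ → ℕ
σ m = length (divisors m)

mob : ℕ → ℤ
mob m =
  if does (Data.List.Relation.Unary.Any.any? (λ p → (p ℕ.* p) ∣? m) (primeDivisors m))
  then + 0
  else (ℤ.- ℤ.1ℤ) ℤ.^ length (primeDivisors m)
  where import Data.List.Relation.Unary.Any

ℕtoℚ : ℕ → ℚ
ℕtoℚ k = + k ℚ./ 1

ν : ℕ → ℚ
ν N = ℕtoℚ N ℚ.* prodℚ (map (λ p → 1ℚ ℚ.+ inv p) (primeDivisors N))
  where
  inv : ℕ → ℚ
  inv zero = 0ℚ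
  inv (suc k) = + 1 ℚ./ suc k

-- total rational division (x / 0 := 0; never used with 0 below)
_÷ℚ_ : ℚ → ℚ → ℚ
x ÷ℚ y with y ℚP.≟ 0ℚ
... | yes _ = 0ℚ
... | no y≢0 = ℚ._÷_ x y {{ℚ.≢-nonZero y≢0}}

-- total natural division (m / 0 := 0; never used with 0 below)
_/ℕ_ : ℕ → ℕ → ℕ
m /ℕ zero = 0
m /ℕ suc k = m ℕ./ suc k

M : ℤ → ℤ → ℕ → ℕ
M t n zero = 0
M t n (suc k) =
  length (filter (λ x → ((+ x) ℤ.* (+ x) ℤ.- t ℤ.* (+ x) ℤ.+ n) %ℕ suc k ℕ.≟ 0) (upTo (suc k)))

μ : ℤ → ℕ → ℤ → ℕ → ℚ
μ t f n d =
  (ν d ÷ℚ ν (d /ℕ gcd d f)) ℚ.* ℕtoℚ (M t n (d ℕ.* gcd d f))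

μ̃ : ℤ → ℕ → ℤ → ℕ → ℚ
μ̃ t f n N =
  sumℚ (map (λ d → ℕtoℚ (σ (N /ℕ d)) ℚ.* (mob (N /ℕ d) ℚ./ 1) ℚ.* μ t f n d) (divisors N))

legendre : ℤ → ℕ → ℤ
legendre a zero = + 0
legendre a (suc k) =
  if does ((a %ℕ suc k) ℕ.≟ 0) then + 0
  else if does (Data.List.Relation.Unary.Any.any?
                  (λ x → ((+ x) ℤ.* (+ x) ℤ.- a) %ℕ suc k ℕ.≟ 0) (upTo (suc k)))
  then + 1 else ℤ.-1ℤ
  where import Data.List.Relation.Unary.Any

Squarefree : ℕ → Set
Squarefree N = ∀ (d : ℕ) → (d ℕ.* d) ∣ N → d ≡ 1

module Submission where

-- Write χ(x) = x² - t x + n for the characteristic polynomial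
-- of the trace t and norm n.  Every prime p ∣ N forbids roots of χ modulo p:
--   * for p = 2, t ≡ n₀ is odd and n is odd, so χ(x) = x(x+1) - x(t+1) + n
--     is odd for every x;
--   * for odd p, a root x would make (2x - t) a square root of
--     t² - 4n ≡ n₀² - 4n modulo p, contradicting the Legendre hypothesis.
-- Hence M(t,n,K) = 0 whenever some prime divisor of N divides K.  In the
-- divisor sum μ̃(t,f,n,N) = Σ_{d∣N} σ(N/d) μ(N/d) μ(t,f,n,d), every d ≥ 2
-- has a prime factor p ∣ N dividing d·gcd(d,f), so its summand vanishes, and
-- only d = 1 survives, contributing σ(N) μ(N) · ν(1)/ν(1) · M(t,n,1) = σ(N) μ(N).

open import Defs
open import Data.Bool using (true; false; if_then_else_)
open import Data.Empty using (⊥-elim)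
open import Data.Integer as ℤ using (ℤ; +_; -[1+_]; _%ℕ_)
import Data.Integer.Divisibility as ℤD
open import Data.Integer.Divisibility.Signed as ZS using (_∣_; divides)
import Data.Integer.DivMod as ZDM
import Data.Integer.Properties as ZP
open import Data.Integer.Tactic.RingSolver using (solve-∀)
open import Data.List using (List; []; _∷_; filter; length; upTo; map; applyUpTo)
open import Data.List.Membership.Propositional using (lose)
open import Data.List.Membership.Propositional.Properties using (∈-upTo⁺)
open import Data.List.Properties using (filter-none; filter-accept)
open import Data.List.Relation.Unary.All as All using (All)
open import Data.List.Relation.Unary.All.Properties using (all-filter; filter⁺; map⁺; applyUpTo⁺₂)
open import Data.List.Relation.Unary.Any using (any?)
open import Data.Nat as ℕ using (ℕ; zero; suc; _%_)
open import Data.Nat.Coprimality using (Coprime)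
import Data.Nat.DivMod as ℕDM
import Data.Nat.Divisibility as ℕD
import Data.Nat.Properties as NP
open import Data.Nat.GCD using (gcd; gcd-zeroˡ)
open import Data.Nat.ListAction using (product)
open import Data.Nat.Primality using (Prime)
open import Data.Nat.Primality.Factorisation using (factorise)
open import Data.Product using (Σ; _×_; _,_)
open import Data.Rational as ℚ using (ℚ; 0ℚ)
import Data.Rational.Properties as ℚP
open import Data.Sum using (_⊎_; inj₁; inj₂)
open import Relation.Nullary using (Dec; does; yes; no; ¬_)
open import Relation.Nullary.Decidable using (dec-true)
open import Relation.Binary.PropositionalEquality
open ≡-Reasoning

∣⇒%ℕ≡0 : ∀ a k .{{_ : ℕ.NonZero k}} → + k ∣ a → a %ℕ k ≡ 0
∣⇒%ℕ≡0 (+ m)    k k∣a = ℕD.n∣m⇒m%n≡0 m k (ZS.∣⇒∣ᵤ k∣a)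
∣⇒%ℕ≡0 -[1+ m ] k k∣a with suc m % k | ℕD.n∣m⇒m%n≡0 (suc m) k (ZS.∣⇒∣ᵤ k∣a)
... | zero | _ = refl
... | suc _ | ()

%ℕ≡0⇒∣ : ∀ a k .{{_ : ℕ.NonZero k}} → a %ℕ k ≡ 0 → + k ∣ a
%ℕ≡0⇒∣ a k r≡0 = divides (a ℤ./ℕ k) (begin
  a                                    ≡⟨ ZDM.a≡a%ℕn+[a/ℕn]*n a k ⟩
  + (a %ℕ k) ℤ.+ (a ℤ./ℕ k) ℤ.* + k   ≡⟨ cong (λ r → + r ℤ.+ (a ℤ./ℕ k) ℤ.* + k) r≡0 ⟩
  + 0 ℤ.+ (a ℤ./ℕ k) ℤ.* + k          ≡⟨ ZP.+-identityˡ _ ⟩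
  (a ℤ./ℕ k) ℤ.* + k                   ∎)

∣-minus-%ℕ : ∀ a k .{{_ : ℕ.NonZero k}} → + k ∣ (a ℤ.- + (a %ℕ k))
∣-minus-%ℕ a k = divides q (begin
  a ℤ.- + r                       ≡⟨ cong (ℤ._- + r) (ZDM.a≡a%ℕn+[a/ℕn]*n a k) ⟩
  + r ℤ.+ q ℤ.* + k ℤ.- + r       ≡⟨ add-sub-cancel (+ r) (q ℤ.* + k) ⟩
  q ℤ.* + k                       ∎)
  where
  r : ℕ
  r = a %ℕ k
  q : ℤ
  q = a ℤ./ℕ k
  add-sub-cancel : ∀ (u v : ℤ) → u ℤ.+ v ℤ.- u ≡ v
  add-sub-cancel = solve-∀

square-%ℕ : ∀ w k .{{_ : ℕ.NonZero k}} →
  + k ∣ (+ (w %ℕ k) ℤ.* + (w %ℕ k) ℤ.- w ℤ.* w)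
square-%ℕ w k = subst (+ k ∣_) (sym (difference-of-squares (+ (w %ℕ k)) w))
  (ZS.∣m⇒∣m*n _ (∣-minus-%ℕ w k))
  where
  difference-of-squares : ∀ (y v : ℤ) → y ℤ.* y ℤ.- v ℤ.* v ≡ (v ℤ.- y) ℤ.* (ℤ.- v ℤ.- y)
  difference-of-squares = solve-∀

square-found-≢-1 : ∀ b c → c ≡ true → (if b then + 0 else (if c then + 1 else ℤ.-1ℤ)) ≢ ℤ.-1ℤ
square-found-≢-1 false .true refl ()
square-found-≢-1 true  .true refl ()

legendre-square : ∀ a p y → y ℕ.< p → + p ∣ (+ y ℤ.* + y ℤ.- a) → legendre a p ≢ ℤ.-1ℤ
legendre-square a zero    y ()  _
legendre-square a (suc k) y y<p p∣y²-a =
  square-found-≢-1 (does ((a %ℕ suc k) ℕ.≟ 0)) (does (any? root? (upTo (suc k))))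
    (dec-true (any? root? (upTo (suc k))) (lose (∈-upTo⁺ y<p) (∣⇒%ℕ≡0 _ (suc k) p∣y²-a)))
  where
  root? : ∀ x → Dec (((+ x) ℤ.* (+ x) ℤ.- a) %ℕ suc k ≡ 0)
  root? x = ((+ x) ℤ.* (+ x) ℤ.- a) %ℕ suc k ℕ.≟ 0

charPoly : ℤ → ℤ → ℕ → ℤ
charPoly t n x = + x ℤ.* + x ℤ.- t ℤ.* + x ℤ.+ n

-- A root modulo K is a root modulo every divisor p of K; so if there are no
-- roots modulo p, then M(t,n,K) = 0.
M-no-root : ∀ t n K p → p ℕD.∣ K → (∀ x → ¬ (+ p ∣ charPoly t n x)) → M t n K ≡ 0
M-no-root t n zero    p _   _       = refl
M-no-root t n (suc k) p p∣K no-root = cong length (filter-none root? {upTo (suc k)} (All.universal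
  (λ x r≡0 → no-root x (ZS.∣-trans (ZS.∣ᵤ⇒∣ p∣K) (%ℕ≡0⇒∣ _ (suc k) r≡0))) _))
  where
  root? : ∀ x → Dec (charPoly t n x %ℕ suc k ≡ 0)
  root? x = charPoly t n x %ℕ suc k ℕ.≟ 0

M-one : ∀ t n → M t n 1 ≡ 1
M-one t n = cong length (filter-accept root? {0} {[]}
  (∣⇒%ℕ≡0 (charPoly t n 0) 1 (ZS.∣ᵤ⇒∣ (ℕD.1∣ _))))
  where
  root? : ∀ x → Dec (charPoly t n x %ℕ 1 ≡ 0)
  root? x = charPoly t n x %ℕ 1 ℕ.≟ 0

completing-square : ∀ (t n₀ n x : ℤ) →
  (+ 2 ℤ.* x ℤ.- t) ℤ.* (+ 2 ℤ.* x ℤ.- t) ℤ.- (n₀ ℤ.* n₀ ℤ.- + 4 ℤ.* n)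
    ≡ + 4 ℤ.* (x ℤ.* x ℤ.- t ℤ.* x ℤ.+ n) ℤ.+ (t ℤ.- n₀) ℤ.* (t ℤ.+ n₀)
completing-square = solve-∀

-- If (n₀² - 4n / p) = -1 and t ≡ n₀ (mod p), then χ has no root modulo p:
-- a root x would make the remainder of 2x - t a square root of n₀² - 4n.
no-root-legendre : ∀ t n n₀ p → legendre (+ (n₀ ℕ.* n₀) ℤ.- + (4 ℕ.* n)) p ≡ ℤ.-1ℤ →
  + p ∣ (t ℤ.- + n₀) → ∀ x → ¬ (+ p ∣ charPoly t (+ n) x)
no-root-legendre t n n₀ zero    ()        _
no-root-legendre t n n₀ (suc k) symbol≡-1 p∣t-n₀ x p∣χ =
  legendre-square disc (suc k) y (ZDM.n%ℕd<d w (suc k)) p∣y²-disc symbol≡-1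
  where
  disc : ℤ
  disc = + (n₀ ℕ.* n₀) ℤ.- + (4 ℕ.* n)
  w : ℤ
  w = + 2 ℤ.* + x ℤ.- t
  y : ℕ
  y = w %ℕ suc k
  disc≡ : disc ≡ + n₀ ℤ.* + n₀ ℤ.- + 4 ℤ.* + n
  disc≡ = cong₂ ℤ._-_ (ZP.pos-* n₀ n₀) (ZP.pos-* 4 n)
  p∣w²-disc : + suc k ∣ (w ℤ.* w ℤ.- disc)
  p∣w²-disc rewrite disc≡ | completing-square t (+ n₀) (+ n) (+ x) =
    ZS.∣m∣n⇒∣m+n (ZS.∣n⇒∣m*n (+ 4) p∣χ) (ZS.∣m⇒∣m*n _ p∣t-n₀)
  telescope : ∀ (u v c : ℤ) → (u ℤ.- v) ℤ.+ (v ℤ.- c) ≡ u ℤ.- c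
  telescope = solve-∀
  p∣y²-disc : + suc k ∣ (+ y ℤ.* + y ℤ.- disc)
  p∣y²-disc = subst (+ suc k ∣_) (telescope (+ y ℤ.* + y) (w ℤ.* w) disc)
    (ZS.∣m∣n⇒∣m+n (square-%ℕ w (suc k)) p∣w²-disc)

even-or-even-suc : ∀ m → 2 ℕD.∣ m ⊎ 2 ℕD.∣ suc m
even-or-even-suc zero = inj₁ (2 ℕD.∣0)
even-or-even-suc (suc m) with even-or-even-suc m
... | inj₁ 2∣m  = inj₂ (ℕD.∣m∣n⇒∣m+n ℕD.∣-refl 2∣m)
... | inj₂ 2∣1+m = inj₁ 2∣1+m

even-consecutive : ∀ m → 2 ℕD.∣ m ℕ.* suc m
even-consecutive m with even-or-even-suc m
... | inj₁ 2∣m   = ℕD.∣m⇒∣m*n (suc m) 2∣m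
... | inj₂ 2∣1+m = ℕD.∣n⇒∣m*n m 2∣1+m

odd⇒¬even : ∀ {m} → m % 2 ≡ 1 → ¬ (2 ℕD.∣ m)
odd⇒¬even {m} m-odd 2∣m with trans (sym (ℕD.n∣m⇒m%n≡0 m 2 2∣m)) m-odd
... | ()

odd⇒even-suc : ∀ {m} → m % 2 ≡ 1 → 2 ℕD.∣ suc m
odd⇒even-suc {m} m-odd with even-or-even-suc m
... | inj₁ 2∣m   = ⊥-elim (odd⇒¬even m-odd 2∣m)
... | inj₂ 2∣1+m = 2∣1+m

-- n = χ(x) - x(x+1) + x((t - n₀) + (n₀ + 1)), every term but n visibly even.
isolate-norm : ∀ (t n₀ n x : ℤ) →
  n ≡ (x ℤ.* x ℤ.- t ℤ.* x ℤ.+ n) ℤ.- x ℤ.* (+ 1 ℤ.+ x)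
        ℤ.+ x ℤ.* ((t ℤ.- n₀) ℤ.+ (+ 1 ℤ.+ n₀))
isolate-norm = solve-∀

no-root-two : ∀ t n n₀ → n % 2 ≡ 1 → n₀ % 2 ≡ 1 →
  + 2 ∣ (t ℤ.- + n₀) → ∀ x → ¬ (+ 2 ∣ charPoly t (+ n) x)
no-root-two t n n₀ n-odd n₀-odd 2∣t-n₀ x 2∣χ = odd⇒¬even n-odd (ZS.∣⇒∣ᵤ 2∣n)
  where
  2∣x[x+1] : + 2 ∣ + x ℤ.* (+ 1 ℤ.+ + x)
  2∣x[x+1] = subst (+ 2 ∣_) (ZP.pos-* x (suc x)) (ZS.∣ᵤ⇒∣ (even-consecutive x))
  2∣t+1 : + 2 ∣ (t ℤ.- + n₀) ℤ.+ (+ 1 ℤ.+ + n₀)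
  2∣t+1 = ZS.∣m∣n⇒∣m+n 2∣t-n₀ (ZS.∣ᵤ⇒∣ (odd⇒even-suc n₀-odd))
  2∣n : + 2 ∣ + n
  2∣n = subst (+ 2 ∣_) (sym (isolate-norm t (+ n₀) (+ n) (+ x)))
    (ZS.∣m∣n⇒∣m+n (ZS.∣m∣n⇒∣m-n 2∣χ 2∣x[x+1]) (ZS.∣n⇒∣m*n (+ x) 2∣t+1))

-- Every d ≥ 2 has a prime divisor: the first factor of its factorisation.
prime-divisor : ∀ d → 2 ℕ.≤ d → Σ ℕ λ p → Prime p × p ℕD.∣ d
prime-divisor d@(suc (suc _)) _ with factorise d
... | record { factors = [] ; isFactorisation = () }
... | record { factors = p ∷ ps ; isFactorisation = d≡p*ps ; factorsPrime = p-prime All.∷ _ } =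
  p , p-prime , ℕD.divides (product ps) (trans d≡p*ps (NP.*-comm p (product ps)))
prime-divisor 1 (ℕ.s≤s ())

divisors-split : ∀ k → Σ (List ℕ) λ ds →
  divisors (suc k) ≡ 1 ∷ ds × All (λ d → 2 ℕ.≤ d × d ℕD.∣ suc k) ds
divisors-split k = filter (ℕD._∣? suc k) candidates
  , filter-accept (ℕD._∣? suc k) (ℕD.1∣ suc k)
  , All.zip (filter⁺ (ℕD._∣? suc k) (map⁺ (applyUpTo⁺₂ suc k (λ _ → ℕ.s≤s (ℕ.s≤s ℕ.z≤n))))
            , all-filter (ℕD._∣? suc k) candidates)
  where
  candidates : List ℕ
  candidates = map suc (applyUpTo suc k)

sum-vanishing : ∀ (g : ℕ → ℚ) ds → All (λ d → g d ≡ 0ℚ) ds → sumℚ (map g ds) ≡ 0ℚ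
sum-vanishing g []       All.[]            = refl
sum-vanishing g (d ∷ ds) (gd≡0 All.∷ rest) =
  trans (cong₂ ℚ._+_ gd≡0 (sum-vanishing g ds rest)) (ℚP.+-identityʳ 0ℚ)

μ̃-term : ℤ → ℕ → ℤ → ℕ → ℕ → ℚ
μ̃-term t f n N d = ℕtoℚ (σ (N /ℕ d)) ℚ.* (mob (N /ℕ d) ℚ./ 1) ℚ.* μ t f n d

μ̃-term-vanishes : ∀ t f n N d → M t n (d ℕ.* gcd d f) ≡ 0 → μ̃-term t f n N d ≡ 0ℚ
μ̃-term-vanishes t f n N d M≡0 rewrite M≡0 =
  trans (cong (coefficient ℚ.*_) (ℚP.*-zeroʳ (ν d ÷ℚ ν (d /ℕ gcd d f)))) (ℚP.*-zeroʳ coefficient)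
  where
  coefficient : ℚ
  coefficient = ℕtoℚ (σ (N /ℕ d)) ℚ.* (mob (N /ℕ d) ℚ./ 1)

-- The d = 1 summand equals σ(N) μ(N), since ν(1)/ν(1) = 1 and M(t,n,1) = 1.
μ̃-term-one : ∀ t f n N → μ̃-term t f n N 1 ≡ ℕtoℚ (σ N) ℚ.* (mob N ℚ./ 1)
μ̃-term-one t f n N rewrite gcd-zeroˡ f | M-one t n | ℕDM.n/1≡n N = ℚP.*-identityʳ _

lemma4p8 :
    (N : ℕ) → 0 ℕ.< N → Squarefree N →
    (n : ℕ) → n % 2 ≡ 1 → 0 ℕ.< n → Coprime n N →
    (n₀ : ℕ) → n₀ % 2 ≡ 1 → 0 ℕ.< n₀ → n₀ ℕ.< 2 ℕ.* N →
    (∀ (p : ℕ) → Prime p → p ≢ 2 → p ℕD.∣ N →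
      legendre (+ (n₀ ℕ.* n₀) ℤ.- + (4 ℕ.* n)) p ≡ ℤ.-1ℤ) →
    (t : ℤ) → (+ (2 ℕ.* N)) ℤD.∣ (t ℤ.- + n₀) → t ℤ.* t ℤ.< + (4 ℕ.* n) →
    (f : ℕ) → 0 ℕ.< f →
    (D : ℤ) → t ℤ.* t ℤ.- + (4 ℕ.* n) ≡ + (f ℕ.* f) ℤ.* D →
    (D %ℕ 4 ≡ 0 ⊎ D %ℕ 4 ≡ 1) →
    μ̃ t f (+ n) N ≡ ℕtoℚ (σ N) ℚ.* (mob N ℚ./ 1)
lemma4p8 N@(suc k) _ _ n n-odd _ _ n₀ n₀-odd _ _ symbol≡-1 t 2N∣t-n₀ _ f _ _ _ _
  with divisors-split k
... | ds , divisors≡ , ds-large = begin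
  sumℚ (map term (divisors N))   ≡⟨ cong (λ L → sumℚ (map term L)) divisors≡ ⟩
  term 1 ℚ.+ sumℚ (map term ds)  ≡⟨ cong (term 1 ℚ.+_) (sum-vanishing term ds (All.map large-vanishes ds-large)) ⟩
  term 1 ℚ.+ 0ℚ                  ≡⟨ ℚP.+-identityʳ _ ⟩
  term 1                         ≡⟨ μ̃-term-one t f (+ n) N ⟩
  ℕtoℚ (σ N) ℚ.* (mob N ℚ./ 1)   ∎
  where
  term : ℕ → ℚ
  term = μ̃-term t f (+ n) N
  p∣t-n₀ : ∀ {p} → p ℕD.∣ 2 ℕ.* N → + p ∣ (t ℤ.- + n₀)
  p∣t-n₀ p∣2N = ZS.∣-trans (ZS.∣ᵤ⇒∣ p∣2N) (ZS.∣ᵤ⇒∣ {+ (2 ℕ.* N)} 2N∣t-n₀)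
  no-root : ∀ p → Prime p → p ℕD.∣ N → ∀ x → ¬ (+ p ∣ charPoly t (+ n) x)
  no-root p p-prime p∣N with p ℕ.≟ 2
  ... | yes refl = no-root-two t n n₀ n-odd n₀-odd (p∣t-n₀ (ℕD.m∣m*n N))
  ... | no p≢2   = no-root-legendre t n n₀ p (symbol≡-1 p p-prime p≢2 p∣N)
                     (p∣t-n₀ (ℕD.∣-trans p∣N (ℕD.n∣m*n 2)))
  -- Summands with d ≥ 2 vanish, via a prime divisor of d.
  large-vanishes : ∀ {d} → 2 ℕ.≤ d × d ℕD.∣ N → term d ≡ 0ℚ
  large-vanishes {d} (2≤d , d∣N) with prime-divisor d 2≤d
  ... | p , p-prime , p∣d = μ̃-term-vanishes t f (+ n) N d
          (M-no-root t (+ n) _ p (ℕD.∣-trans p∣d (ℕD.m∣m*n (gcd d f)))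
            (no-root p p-prime (ℕD.∣-trans p∣d d∣N)))
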